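{- Let $\Phi$ be an instance of monotone NAE 3-SAT with variables $x_1,\dots,x_n$ and clauses $C_1,\dots,C_m$. Let $G(\Phi)$ be the graph with vertex set $\{x_1,\dots,x_n\}\cup\{c_{j,k}:1\le j\le m,\ 1\le k\le 3\}$, with edges $c_{j,1}c_{j,2}$, $c_{j,1}c_{j,3}$, $c_{j,2}c_{j,3}$ for each $j$, and an edge $x_ic_{j,k}$ whenever $x_i$ is the $k$-th literal of clause $C_j$. If $mag^+(G(\Phi))=|V(G(\Phi))|=n+3m$, then $\Phi$ is satisfiable (in the not-all-equal sense).
   Context: An instance of monotone NAE 3-SAT is a CNF formula in which each clause consists of exactly three positive literals (no negations), no variable appearing twice in the same clause; it is satisfiable if there is a truth assignment such that every clause contains at least one true and at least one false literal. For an oriented graph $\vec G$, two distinct vertices $x,y$ monitor an arc $a$ if $a$ lies on every shortest directed path from $x$ to $y$, or on every shortest directed path from $y$ to $x$. A monitoring arc-geodetic set (MAG-set) is a vertex set $M$ such that every arc is monitored by some pair of distinct vertices of $M$; $mag(\vec G)$ is its minimum size. $mag^+(G)$ is the maximum of $mag(\vec G)$ over orientations $\vec G$ of $G$. -}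

module Defs where

open import Data.Nat using (ℕ; zero; suc; _+_; _*_; _≤_)
open import Data.Fin using (Fin)
open import Data.Bool using (Bool; true; false)
open import Data.Sum using (_⊎_; inj₁; inj₂)
open import Data.Product using (Σ; _×_; _,_; ∃; ∃-syntax)
open import Data.List using (List; length)
open import Data.List.Membership.Propositional using (_∈_)
open import Data.List.Relation.Unary.Unique.Propositional using (Unique)
open import Data.Empty using (⊥)
open import Function.Definitions using (Injective)
open import Relation.Nullary using (¬_)
open import Relation.Binary.PropositionalEquality using (_≡_; _≢_)

record NAE3SAT (n m : ℕ) : Set where
  field
    clause     : Fin m → Fin 3 → Fin n
    distinctLits : ∀ j → Injective _≡_ _≡_ (clause j)

open NAE3SAT public

NAESatisfiable : ∀ {n m} → NAE3SAT n m → Set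
NAESatisfiable {n} {m} Φ =
  Σ (Fin n → Bool) λ σ → ∀ (j : Fin m) →
    (∃[ k ] σ (clause Φ j k) ≡ true) × (∃[ k ] σ (clause Φ j k) ≡ false)

-- vertices: x_i (inj₁ i) and c_{j,k} (inj₂ (j , k))
Vtx : ℕ → ℕ → Set
Vtx n m = Fin n ⊎ (Fin m × Fin 3)

data Edge {n m : ℕ} (Φ : NAE3SAT n m) : Vtx n m → Vtx n m → Set where
  triangle : ∀ j k k′ → k ≢ k′ → Edge Φ (inj₂ (j , k)) (inj₂ (j , k′))
  litᵛᶜ    : ∀ i j k → clause Φ j k ≡ i → Edge Φ (inj₁ i) (inj₂ (j , k))
  litᶜᵛ    : ∀ i j k → clause Φ j k ≡ i → Edge Φ (inj₂ (j , k)) (inj₁ i)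

record Orientation {V : Set} (E : V → V → Set) : Set₁ where
  field
    Arc       : V → V → Set
    arc⇒edge  : ∀ {u v} → Arc u v → E u v
    edge⇒arc  : ∀ {u v} → E u v → Arc u v ⊎ Arc v u
    antisym   : ∀ {u v} → Arc u v → Arc v u → ⊥

data DWalk {V : Set} (A : V → V → Set) : V → V → Set where
  []  : ∀ {x} → DWalk A x x
  _∷_ : ∀ {x y z} → A x y → DWalk A y z → DWalk A x z

walkLength : ∀ {V : Set} {A : V → V → Set} {x y} → DWalk A x y → ℕ
walkLength []      = 0
walkLength (_ ∷ p) = suc (walkLength p)

data UsesArc {V : Set} {A : V → V → Set} (u v : V) :
             ∀ {x y} → DWalk A x y → Set where
  here  : ∀ {z} (a : A u v) (p : DWalk A v z) → UsesArc u v (a ∷ p)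
  there : ∀ {x y z} (a : A x y) {p : DWalk A y z} →
          UsesArc u v p → UsesArc u v (a ∷ p)

-- a shortest directed walk from x to y (shortest walks are paths)
IsShortest : ∀ {V : Set} {A : V → V → Set} {x y} → DWalk A x y → Set
IsShortest {A = A} {x} {y} p = ∀ (q : DWalk A x y) → walkLength p ≤ walkLength q

OnAllShortest : ∀ {V : Set} (A : V → V → Set) (x y u v : V) → Set
OnAllShortest A x y u v =
  DWalk A x y × (∀ (p : DWalk A x y) → IsShortest p → UsesArc u v p)

Monitors : ∀ {V : Set} (A : V → V → Set) (x y u v : V) → Set
Monitors A x y u v = x ≢ y × (OnAllShortest A x y u v ⊎ OnAllShortest A y x u v)

IsMAG : ∀ {V : Set} (A : V → V → Set) (M : List V) → Set
IsMAG A M = ∀ u v → A u v →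
  ∃[ x ] ∃[ y ] (x ∈ M × y ∈ M × Monitors A x y u v)

MagAtLeast : ∀ {V : Set} (A : V → V → Set) (k : ℕ) → Set
MagAtLeast {V} A k = ∀ (M : List V) → Unique M → IsMAG A M → k ≤ length M

-- mag⁺(G(Φ)) = |V(G(Φ))| = n + 3m  (since mag ≤ |V| always, this is:
-- some orientation has every MAG-set of size ≥ n + 3m)
MagPlusIsOrder : ∀ {n m} → NAE3SAT n m → Set₁
MagPlusIsOrder {n} {m} Φ =
  Σ (Orientation (Edge Φ)) λ O → MagAtLeast (Orientation.Arc O) (n + 3 * m)

{-# OPTIONS --safe #-}
module Submission where

-- Call a vertex v bridged if every arc at v is one of the two arcs of a
-- path u → v → w that is the unique shortest u–w path (no arc u → w, and v
-- the only middle vertex).  Then u, w ≠ v monitor that arc, so V ∖ {v} is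
-- a MAG-set; hence mag = |V| rules out bridged vertices.  In G(Φ), a
-- variable with both an in-arc and an out-arc is bridged, so every variable
-- is a source or a sink, and σ(x_i) = "x_i has an out-arc" is the
-- candidate assignment.  If the three literal arcs of a clause all point into its
-- triangle (or all out of it), a king of the triangle tournament that is
-- not a sink is bridged; so every clause gets a true and a false literal.

open import Defs
open import Data.Nat using (ℕ; _+_; _*_; _≤_; _<_; s≤s)
open import Data.Nat.Properties using (<⇒≱)
open import Data.Fin using (Fin; _≟_)
open import Data.Fin.Patterns using (0F; 1F; 2F)
open import Data.Fin.Properties using (any?; all?; ¬∀⟶∃¬; +↔⊎; *↔×)
open import Data.Bool using (Bool; true; false)
open import Data.Sum using (_⊎_; inj₁; inj₂)
open import Data.Sum.Function.Propositional using (_⊎-↔_)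
open import Data.Product using (∃; ∃₂; _×_; _,_; proj₁; proj₂; map₂; uncurry)
open import Data.Product.Algebra using (×-comm)
open import Data.List using (List; length; filter; tabulate)
open import Data.List.Properties using (length-tabulate; filter-notAll)
open import Data.List.Membership.Propositional using (_∈_)
open import Data.List.Membership.Propositional.Properties using (∈-tabulate⁺; ∈-filter⁺)
open import Data.List.Relation.Unary.Unique.Propositional using (Unique)
import Data.List.Relation.Unary.Unique.Propositional.Properties as Unique
import Data.List.Relation.Unary.Any as Any
open import Data.Empty using (⊥-elim)
open import Function using (_∘_; flip; _↔_; Inverse; Injection)
open import Function.Properties.Inverse using (↔⇒↣)
open import Function.Construct.Composition using (_↔-∘_)
open import Function.Construct.Identity using (↔-id)
open import Function.Construct.Symmetry using (↔-sym)
open import Relation.Nullary using (¬_; Dec; yes; no; does; ¬?)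
open import Relation.Nullary.Decidable using (dec-true; dec-false; via-injection; toWitness; _→-dec_)
open import Relation.Binary.Definitions using (DecidableEquality)
open import Relation.Binary.PropositionalEquality using (_≡_; _≢_; refl; sym; cong; subst)

record Bridge {V : Set} (A : V → V → Set) (u v w : V) : Set where
  field
    first         : A u v
    second        : A v w
    no-shortcut   : ¬ A u w
    ends-distinct : u ≢ w
    unique-middle : ∀ {y} → A u y → A y w → y ≡ v

Bridged : ∀ {V : Set} (A : V → V → Set) → V → Set
Bridged A v = (∀ {w} → A v w → ∃ λ u → Bridge A u v w)
            × (∀ {u} → A u v → ∃ λ w → Bridge A u v w)

Bridge-flip : ∀ {V : Set} {A : V → V → Set} {u v w} → Bridge (flip A) w v u → Bridge A u v w
Bridge-flip b = record
  { first         = second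
  ; second        = first
  ; no-shortcut   = no-shortcut
  ; ends-distinct = ends-distinct ∘ sym
  ; unique-middle = λ a a′ → unique-middle a′ a
  }
  where open Bridge b

Bridged-flip : ∀ {V : Set} {A : V → V → Set} {v} → Bridged (flip A) v → Bridged A v
Bridged-flip (outs , ins) = map₂ Bridge-flip ∘ ins , map₂ Bridge-flip ∘ outs

module _ {V : Set} {A : V → V → Set} (asym : ∀ {u v} → A u v → ¬ A v u) where

  irreflexive : ∀ {u v} → A u v → u ≢ v
  irreflexive a refl = asym a a

  arc-monitors-itself : ∀ {u w} → A u w → Monitors A u w u w
  arc-monitors-itself a = irreflexive a , inj₁ (a ∷ [] , λ p shortest → along p (shortest (a ∷ [])))
    where
    along : ∀ p → walkLength p ≤ 1 → UsesArc _ _ p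
    along []            _        = ⊥-elim (asym a a)
    along (a′ ∷ [])     _        = here a′ []
    along (_ ∷ (_ ∷ _)) (s≤s ())

  bridge-walk : ∀ {u v w} → Bridge A u v w →
                (p : DWalk A u w) → walkLength p ≤ 2 → UsesArc u v p × UsesArc v w p
  bridge-walk b []                  _ = ⊥-elim (Bridge.ends-distinct b refl)
  bridge-walk b (a ∷ [])            _ = ⊥-elim (Bridge.no-shortcut b a)
  bridge-walk b (a ∷ (a′ ∷ []))     _ with Bridge.unique-middle b a a′
  ... | refl = here a (a′ ∷ []) , there a (here a′ [])
  bridge-walk b (_ ∷ (_ ∷ (_ ∷ _))) (s≤s (s≤s ()))

  bridge-monitors : ∀ {u v w} → Bridge A u v w → Monitors A u w u v × Monitors A u w v w
  bridge-monitors {u} {v} {w} b = (ends-distinct , inj₁ (path , λ p sh → proj₁ (along p sh)))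
                                , (ends-distinct , inj₁ (path , λ p sh → proj₂ (along p sh)))
    where
    open Bridge b
    path : DWalk A u w
    path = first ∷ (second ∷ [])
    along : ∀ p → IsShortest p → UsesArc u v p × UsesArc v w p
    along p shortest = bridge-walk b p (shortest path)

  bridge-ends-≢-middle : ∀ {u v w} → Bridge A u v w → u ≢ v × w ≢ v
  bridge-ends-≢-middle b = irreflexive (Bridge.first b) , irreflexive (Bridge.second b) ∘ sym

module _ {N : ℕ} {V : Set} (enum : Fin N ↔ V) {A : V → V → Set}
         (asym : ∀ {u v} → A u v → ¬ A v u) where

  open Inverse enum using (to; from; strictlyInverseˡ)

  private
    _≟ᵥ_ : DecidableEquality V
    _≟ᵥ_ = via-injection (↔⇒↣ (↔-sym enum)) _≟_

    vertices : List V
    vertices = tabulate to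

    ∈-vertices : ∀ v → v ∈ vertices
    ∈-vertices v = subst (_∈ vertices) (strictlyInverseˡ v) (∈-tabulate⁺ (from v))

  all-but : V → List V
  all-but v = filter (λ u → ¬? (u ≟ᵥ v)) vertices

  all-but-unique : ∀ v → Unique (all-but v)
  all-but-unique v = Unique.filter⁺ _ (Unique.tabulate⁺ (Injection.injective (↔⇒↣ enum)))

  all-but-shorter : ∀ v → length (all-but v) < N
  all-but-shorter v = subst (length (all-but v) <_) (length-tabulate to)
    (filter-notAll _ vertices (Any.map (λ { refl u≢v → u≢v refl }) (∈-vertices v)))

  monitored-by-others : ∀ {v y z u w} → y ≢ v → z ≢ v → Monitors A y z u w →
                        ∃₂ λ y z → y ∈ all-but v × z ∈ all-but v × Monitors A y z u w
  monitored-by-others y≢v z≢v mon =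
    _ , _ , ∈-filter⁺ _ (∈-vertices _) y≢v , ∈-filter⁺ _ (∈-vertices _) z≢v , mon

  all-but-IsMAG : ∀ {v} → Bridged A v → IsMAG A (all-but v)
  all-but-IsMAG {v} (outs , ins) u w a with u ≟ᵥ v | w ≟ᵥ v
  ... | yes refl | _        = let _ , b = outs a in
    uncurry monitored-by-others (bridge-ends-≢-middle asym b) (proj₂ (bridge-monitors asym b))
  ... | no _     | yes refl = let _ , b = ins a in
    uncurry monitored-by-others (bridge-ends-≢-middle asym b) (proj₁ (bridge-monitors asym b))
  ... | no u≢v   | no w≢v   = monitored-by-others u≢v w≢v (arc-monitors-itself asym a)

  MagAtLeast⇒¬Bridged : MagAtLeast A N → ∀ {v} → ¬ Bridged A v
  MagAtLeast⇒¬Bridged mag {v} bridged =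
    <⇒≱ (all-but-shorter v) (mag (all-but v) (all-but-unique v) (all-but-IsMAG bridged))

reverse : ∀ {V : Set} {E : V → V → Set} → (∀ {u v} → E u v → E v u) → Orientation E → Orientation E
reverse E-sym O = record
  { Arc      = flip Arc
  ; arc⇒edge = E-sym ∘ arc⇒edge
  ; edge⇒arc = edge⇒arc ∘ E-sym
  ; antisym  = flip antisym
  }
  where open Orientation O

module _ {V : Set} {E : V → V → Set} (O : Orientation E) where
  open Orientation O

  arc? : ∀ {u v} → E u v → Dec (Arc u v)
  arc? e with edge⇒arc e
  ... | inj₁ a = yes a
  ... | inj₂ a = no (antisym a)

  ¬all⇒some-reversed : ∀ {r} {u v : Fin r → V} → (∀ k → E (u k) (v k)) →
                       ¬ (∀ k → Arc (u k) (v k)) → ∃ λ k → Arc (v k) (u k)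
  ¬all⇒some-reversed {r} e ¬all with ¬∀⟶∃¬ r _ (arc? ∘ e) ¬all
  ... | k , ¬a with edge⇒arc (e k)
  ...   | inj₁ a = ⊥-elim (¬a a)
  ...   | inj₂ a = k , a

  bridge : ∀ {u v w} → Arc u v → Arc v w → ¬ Arc u w → u ≢ w →
           (∀ {y} → E u y → E y w → y ≡ v) → Bridge Arc u v w
  bridge a a′ no-shortcut u≢w only = record
    { first         = a
    ; second        = a′
    ; no-shortcut   = no-shortcut
    ; ends-distinct = u≢w
    ; unique-middle = λ b b′ → only (arc⇒edge b) (arc⇒edge b′)
    }

module _ {R : Fin 3 → Fin 3 → Set} (asym : ∀ {k l} → R k l → ¬ R l k)
         (total : ∀ {k l} → k ≢ l → R k l ⊎ R l k) where

  IsKing : Fin 3 → Set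
  IsKing k = (∃ λ l → R k l) × (∀ {l} → R l k → ∃ λ p → R k p × R p l)

  source-is-king : ∀ {k} → (∃ λ l → R k l) → (∀ {y} → ¬ R y k) → IsKing k
  source-is-king out unbeaten = out , ⊥-elim ∘ unbeaten

  king : ∃ IsKing
  king with total {0F} {1F} (λ ()) | total {0F} {2F} (λ ()) | total {1F} {2F} (λ ())
  ... | inj₁ a | inj₁ b | _ = 0F , source-is-king (1F , a)
    λ { {0F} r → asym r r ; {1F} r → asym r a ; {2F} r → asym r b }
  ... | inj₁ a | inj₂ b | inj₁ c = 0F , (1F , a) ,
    λ { {0F} r → ⊥-elim (asym r r) ; {1F} r → ⊥-elim (asym r a) ; {2F} _ → 1F , a , c }
  ... | inj₁ a | inj₂ b | inj₂ c = 2F , source-is-king (0F , b)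
    λ { {0F} r → asym r b ; {1F} r → asym r c ; {2F} r → asym r r }
  ... | inj₂ a | inj₁ b | inj₁ c = 1F , source-is-king (0F , a)
    λ { {0F} r → asym r a ; {1F} r → asym r r ; {2F} r → asym r c }
  ... | inj₂ a | inj₁ b | inj₂ c = 0F , (2F , b) ,
    λ { {0F} r → ⊥-elim (asym r r) ; {1F} _ → 2F , b , c ; {2F} r → ⊥-elim (asym r b) }
  ... | inj₂ a | inj₂ b | inj₁ c = 1F , source-is-king (0F , a)
    λ { {0F} r → asym r a ; {1F} r → asym r r ; {2F} r → asym r c }
  ... | inj₂ a | inj₂ b | inj₂ c = 2F , source-is-king (0F , b)
    λ { {0F} r → asym r b ; {1F} r → asym r c ; {2F} r → asym r r }

fin3-third : ∀ (k l p y : Fin 3) → k ≢ l → k ≢ p → l ≢ p → y ≢ l → y ≢ p → y ≡ k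
fin3-third = toWitness {a? = all? λ k → all? λ l → all? λ p → all? λ y →
  ¬? (k ≟ l) →-dec ¬? (k ≟ p) →-dec ¬? (l ≟ p) →-dec ¬? (y ≟ l) →-dec ¬? (y ≟ p) →-dec y ≟ k} _

Vtx↔Fin : ∀ {n m} → Fin (n + 3 * m) ↔ Vtx n m
Vtx↔Fin {n} {m} = (↔-id (Fin n) ⊎-↔ (×-comm (Fin 3) (Fin m) ↔-∘ *↔× {3} {m})) ↔-∘ +↔⊎ {n} {3 * m}

x : ∀ {n m} → Fin n → Vtx n m
x = inj₁

c : ∀ {n m} → Fin m → Fin 3 → Vtx n m
c j k = inj₂ (j , k)

module _ {n m : ℕ} (Φ : NAE3SAT n m) where

  private
    lit : Fin m → Fin 3 → Fin n
    lit = clause Φ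

  Edge-sym : ∀ {u v} → Edge Φ u v → Edge Φ v u
  Edge-sym (triangle j k k′ k≢k′) = triangle j k′ k (k≢k′ ∘ sym)
  Edge-sym (litᵛᶜ i j k e)       = litᶜᵛ i j k e
  Edge-sym (litᶜᵛ i j k e)       = litᵛᶜ i j k e

  edge-literal : ∀ {i j k} → Edge Φ (x i) (c j k) → lit j k ≡ i
  edge-literal (litᵛᶜ _ _ _ e) = e

  same-literal : ∀ {j k k′} → lit j k ≡ lit j k′ → c {n} j k ≡ c j k′
  same-literal {j} e = cong (c j) (distinctLits Φ j e)

  occurrences-non-adjacent : ∀ {j k j′ k′} → lit j k ≡ lit j′ k′ → c j k ≢ c j′ k′ →
                             ¬ Edge Φ (c j k) (c j′ k′)
  occurrences-non-adjacent e ne (triangle _ _ _ _) = ne (same-literal e)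

  occurrences-unique-middle : ∀ {j k j′ k′ y} → lit j k ≡ lit j′ k′ → c {n} j k ≢ c j′ k′ →
                              Edge Φ (c j k) y → Edge Φ y (c j′ k′) → y ≡ x (lit j k)
  occurrences-unique-middle e ne (litᶜᵛ _ _ _ refl) _                  = refl
  occurrences-unique-middle e ne (triangle _ _ _ _) (triangle _ _ _ _) = ⊥-elim (ne (same-literal e))

  literal-non-adjacent : ∀ {j k l} → k ≢ l → ¬ Edge Φ (x (lit j k)) (c j l)
  literal-non-adjacent {j} k≢l (litᵛᶜ _ _ _ e) = k≢l (distinctLits Φ j (sym e))

  literal-unique-middle : ∀ {j k l y} → Edge Φ (x (lit j k)) y → Edge Φ y (c j l) → y ≡ c j k
  literal-unique-middle (litᵛᶜ _ _ _ e) (triangle _ _ _ _) = same-literal e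

  clause-unique-middle : ∀ {j k l p y} → k ≢ l → k ≢ p → l ≢ p →
                         Edge Φ (c j l) y → Edge Φ y (c j p) → y ≡ c j k
  clause-unique-middle {j} _ _ l≢p (litᶜᵛ _ _ _ refl) (litᵛᶜ _ _ _ e) = ⊥-elim (l≢p (distinctLits Φ j (sym e)))
  clause-unique-middle {j} {k} {l} {p} k≢l k≢p l≢p (triangle _ _ k′ l≢k′) (triangle _ _ _ k′≢p) =
    cong (c j) (fin3-third k l p k′ k≢l k≢p l≢p (l≢k′ ∘ sym) k′≢p)

  module _ (O : Orientation (Edge Φ)) where
    open Orientation O

    variable-bridge : ∀ {i j k j′ k′} → Arc (c j k) (x i) → Arc (x i) (c j′ k′) →
                      Bridge Arc (c j k) (x i) (c j′ k′)
    variable-bridge a a′ with arc⇒edge a | arc⇒edge a′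
    ... | litᶜᵛ _ _ _ refl | litᵛᶜ _ _ _ e′ =
      bridge O a a′ (occurrences-non-adjacent (sym e′) distinct ∘ arc⇒edge) distinct
        (occurrences-unique-middle (sym e′) distinct)
      where
      distinct : c _ _ ≢ c _ _
      distinct refl = antisym a a′

    literal-bridge : ∀ {j k l} → Arc (x (lit j k)) (c j k) → Arc (c j k) (c j l) →
                     Bridge Arc (x (lit j k)) (c j k) (c j l)
    literal-bridge a a′ =
      bridge O a a′ (literal-non-adjacent (λ { refl → antisym a′ a′ }) ∘ arc⇒edge) (λ ())
        literal-unique-middle

    clause-bridge : ∀ {j k l p} → Arc (c j l) (c j k) → Arc (c j k) (c j p) → Arc (c j p) (c j l) →
                    Bridge Arc (c j l) (c j k) (c j p)
    clause-bridge a a′ a″ =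
      bridge O a a′ (λ b → antisym b a″) (λ { refl → antisym a″ a″ })
        (clause-unique-middle (distinct a ∘ sym) (distinct a′) (distinct a″ ∘ sym))
      where
      distinct : ∀ {j k l} → Arc (c j k) (c j l) → k ≢ l
      distinct b refl = antisym b b

    mixed-variable-bridged : ∀ {i j k j′ k′} → Arc (c j k) (x i) → Arc (x i) (c j′ k′) →
                             Bridged Arc (x i)
    mixed-variable-bridged {i} {j} {k} {j′} {k′} a a′ = outs , ins
      where
      outs : ∀ {w} → Arc (x i) w → ∃ λ u → Bridge Arc u (x i) w
      outs b with arc⇒edge b
      ... | litᵛᶜ _ _ _ _ = c j k , variable-bridge a b
      ins : ∀ {u} → Arc u (x i) → ∃ λ w → Bridge Arc u (x i) w
      ins b with arc⇒edge b
      ... | litᶜᵛ _ _ _ _ = c j′ k′ , variable-bridge b a′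

    all-in-bridged : ∀ {j} → (∀ k → Arc (x (lit j k)) (c j k)) → ∃ λ k → Bridged Arc (c j k)
    all-in-bridged {j} inward with king antisym (λ k≢l → edge⇒arc (triangle j _ _ k≢l))
    ... | k , (l , k→l) , closes = k , outs , ins
      where
      outs : ∀ {w} → Arc (c j k) w → ∃ λ u → Bridge Arc u (c j k) w
      outs b with arc⇒edge b
      ... | litᶜᵛ _ _ _ refl  = ⊥-elim (antisym (inward k) b)
      ... | triangle _ _ _ _ = x (lit j k) , literal-bridge (inward k) b
      ins : ∀ {u} → Arc u (c j k) → ∃ λ w → Bridge Arc u (c j k) w
      ins b with arc⇒edge b
      ... | litᵛᶜ _ _ _ refl  = c j l , literal-bridge b k→l
      ... | triangle _ _ _ _ = let p , k→p , p→l = closes b in c j p , clause-bridge b k→p p→l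

  all-out-bridged : ∀ (O : Orientation (Edge Φ)) {j} → (∀ k → Orientation.Arc O (c j k) (x (lit j k))) →
                    ∃ λ k → Bridged (Orientation.Arc O) (c j k)
  all-out-bridged O outward = map₂ Bridged-flip (all-in-bridged (reverse Edge-sym O) outward)

module _ {n m : ℕ} {Φ : NAE3SAT n m} (O : Orientation (Edge Φ)) where
  open Orientation O

  var→clause? : ∀ i j k → Dec (Arc (x i) (c j k))
  var→clause? i j k with clause Φ j k ≟ i
  ... | yes e = arc? O (litᵛᶜ i j k e)
  ... | no ne = no (ne ∘ edge-literal Φ ∘ arc⇒edge)

  out-arc? : ∀ i → Dec (∃₂ λ j k → Arc (x i) (c j k))
  out-arc? i = any? λ j → any? λ k → var→clause? i j k

  has-out-arc : Fin n → Bool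
  has-out-arc i = does (out-arc? i)

  has-out-arc-true : ∀ {j k} → Arc (x (clause Φ j k)) (c j k) → has-out-arc (clause Φ j k) ≡ true
  has-out-arc-true {j} {k} a = dec-true (out-arc? _) (j , k , a)

  has-out-arc-false : (∀ {v} → ¬ Bridged Arc v) →
                      ∀ {j k} → Arc (c j k) (x (clause Φ j k)) → has-out-arc (clause Φ j k) ≡ false
  has-out-arc-false unbridged a =
    dec-false (out-arc? _) λ (_ , _ , a′) → unbridged (mixed-variable-bridged Φ O a a′)

lemma3 : ∀ (n m : ℕ) (Φ : NAE3SAT n m) → MagPlusIsOrder Φ → NAESatisfiable Φ
lemma3 n m Φ (O , mag) = has-out-arc O , λ j → true-literal j , false-literal j
  where
  open Orientation O

  unbridged : ∀ {v} → ¬ Bridged Arc v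
  unbridged = MagAtLeast⇒¬Bridged Vtx↔Fin antisym mag

  true-literal : ∀ j → ∃ λ k → has-out-arc O (clause Φ j k) ≡ true
  true-literal j = map₂ (has-out-arc-true O)
    (¬all⇒some-reversed O (λ k → litᶜᵛ _ j k refl) (unbridged ∘ proj₂ ∘ all-out-bridged Φ O))

  false-literal : ∀ j → ∃ λ k → has-out-arc O (clause Φ j k) ≡ false
  false-literal j = map₂ (has-out-arc-false O unbridged)
    (¬all⇒some-reversed O (λ k → litᵛᶜ _ j k refl) (unbridged ∘ proj₂ ∘ all-in-bridged Φ O))
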